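{- The Kolakoski sequence $S$ is mirror invariant if and only if for every positive integer $n$ there is a $k$-normal prefix of $S$ for some $k>n$.
   Context: Words are over the alphabet $\{1,2\}$; $|v|$ is the length of $v$. For a finite or infinite word $v=a_1a_2\cdots$, its integral $v^{ -1}$ is obtained by replacing each letter $a_i$ by $a_i$ copies of the letter $1$ if $i$ is odd and by $a_i$ copies of the letter $2$ if $i$ is even. Set $v^0=v$, $v^{ -k}=(v^{ -(k-1)})^{ -1}$. The Kolakoski sequence $S=1221121221\cdots$ is the unique infinite word over $\{1,2\}$ with $S^{ -1}=S$. A prefix $w$ of $S$ is $k$-regular if $|w^{ -h}|$ is even for all $0\le h\le k$, and $k$-normal if it is $k$-regular but not $(k+1)$-regular. The mirror $\widetilde v$ of a word $v$ is obtained by exchanging $1\leftrightarrow2$; $S$ is mirror invariant if the set of its finite subwords is closed under $v\mapsto\widetilde v$. -}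

module Defs where

open import Data.Nat using (ℕ; zero; suc; _+_; _≤_; _<_)
open import Data.Nat.Divisibility using (_∣_)
open import Data.List using (List; []; _∷_; _++_; replicate; length; applyUpTo; map)
open import Data.Product using (Σ; _×_; ∃)
open import Relation.Binary.PropositionalEquality using (_≡_)
open import Relation.Nullary using (¬_)

data Letter : Set where
  one two : Letter

val : Letter → ℕ
val one = 1
val two = 2

flipL : Letter → Letter
flipL one = two
flipL two = one

mirror : List Letter → List Letter
mirror = map flipL

integralFrom : Letter → List Letter → List Letter
integralFrom c []      = []
integralFrom c (a ∷ v) = replicate (val a) c ++ integralFrom (flipL c) v

integral : List Letter → List Letter
integral = integralFrom one

integralPow : ℕ → List Letter → List Letter
integralPow zero    v = v
integralPow (suc h) v = integral (integralPow h v)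

-- infinite words over {1,2}, indexed from 0
Stream : Set
Stream = ℕ → Letter

prefix : Stream → ℕ → List Letter
prefix S m = applyUpTo S m

-- S^{-1} = S, expressed through finite prefixes: for every prefix p of S,
-- p^{-1} is the prefix of S of length |p^{-1}| (these are exactly the
-- prefixes of S^{-1}, since they exhaust it).
IsKolakoski : Stream → Set
IsKolakoski S = ∀ m → integral (prefix S m) ≡ prefix S (length (integral (prefix S m)))

Factor : List Letter → Stream → Set
Factor v S = ∃ λ i → v ≡ applyUpTo (λ j → S (i + j)) (length v)

MirrorInvariant : Stream → Set
MirrorInvariant S = ∀ v → Factor v S → Factor (mirror v) S

Regular : ℕ → List Letter → Set
Regular k w = ∀ h → h ≤ k → 2 ∣ length (integralPow h w)

Normal : ℕ → List Letter → Set
Normal k w = Regular k w × ¬ Regular (suc k) w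

-- Write ℓ m = |(prefix S m)⁻¹|; as S⁻¹ = S, the m-th run of S starts at position ℓ m and has
-- length val (S m), and |(prefix S a)^{-h}| = ℓʰ a.  Say a window of S copies a prefix if it
-- equals it up to mirroring.  A copy of length at least 5 starts at a run boundary ℓ m (S has
-- no three consecutive equal letters), and then the run lengths inside it copy a shorter
-- prefix at m, mirrored exactly when the copy was; its first letter tells whether m is odd.
-- Conversely a copy at m integrates to one at ℓ m, mirrored iff m is odd.  So a long mirrored
-- copy of a prefix descends to a prefix a with ℓʰ a even for h < H and ℓᴴ a odd, i.e. an
-- (H-1)-normal prefix; and a k-normal prefix ascends, through unmirrored copies, to a mirrored
-- copy of a prefix longer than k.
module Submission where

open import Defs
open import Data.Nat using (ℕ; _<_; _≤_)
open import Data.Product using (Σ; _×_; ∃)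
open import Function.Bundles using (_⇔_)
open import Data.Nat using (zero; suc; _+_; z≤n; s≤s; s≤s⁻¹; _≤′_; ≤′-refl; ≤′-step)
open import Data.Nat.Properties
open import Data.Nat.Divisibility using (_∣_; _∣0; ∣-refl; ∣m∣n⇒∣m+n; ∣m+n∣m⇒∣n; >⇒∤)
open import Data.Nat.GeneralisedArithmetic using (fold; fold-+)
open import Data.List using ([]; _∷_; _++_; replicate; length; applyUpTo; map)
open import Data.List.Properties
  using (applyUpTo-∷ʳ; length-applyUpTo; map-applyUpTo; length-map; length-++; length-replicate;
         ++-assoc; ++-identityʳ; ++-cancelˡ; ∷-injectiveˡ; ∷-injectiveʳ)
open import Data.Product using (_,_; ∃₂)
open import Data.Sum using (_⊎_; inj₁; inj₂)
open import Data.Empty using (⊥; ⊥-elim)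
open import Function using (_∘_)
open import Function.Bundles using (mk⇔; Equivalence)
open import Relation.Binary.PropositionalEquality
open import Relation.Nullary using (¬_; yes; no)

private
  variable
    A : Set

flipL-involutive : ∀ c → flipL (flipL c) ≡ c
flipL-involutive one = refl
flipL-involutive two = refl

flipL-≢ : ∀ c → flipL c ≢ c
flipL-≢ one ()
flipL-≢ two ()

val-pos : ∀ c → 0 < val c
val-pos one = s≤s z≤n
val-pos two = s≤s z≤n

val-≤2 : ∀ c → val c ≤ 2
val-≤2 one = s≤s z≤n
val-≤2 two = ≤-refl

1<val⇒two : ∀ {c} → 1 < val c → c ≡ two
1<val⇒two {one} (s≤s ())
1<val⇒two {two} _ = refl

next-start-cases : ∀ a {c s} → s < val c → a + val c ≡ suc (a + s) ⊎ a + val c ≡ suc (suc (a + s))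
next-start-cases a {one} {zero} _ = inj₁ (+-suc a 0)
next-start-cases a {two} {zero} _ = inj₂ (trans (+-suc a 1) (cong suc (+-suc a 0)))
next-start-cases a {two} {suc zero} _ = inj₁ (+-suc a 1)
next-start-cases a {one} {suc _} (s≤s ())
next-start-cases a {two} {suc (suc _)} (s≤s (s≤s ()))

flipⁿ : ℕ → Letter → Letter
flipⁿ n c = fold c flipL n

flipⁿ-flipL : ∀ n c → flipⁿ n (flipL c) ≡ flipL (flipⁿ n c)
flipⁿ-flipL zero c = refl
flipⁿ-flipL (suc n) c = cong flipL (flipⁿ-flipL n c)

flipⁿ-even : ∀ n c → 2 ∣ n → flipⁿ n c ≡ c
flipⁿ-even zero c _ = refl
flipⁿ-even (suc zero) c 2∣1 = ⊥-elim (>⇒∤ (s≤s (s≤s z≤n)) 2∣1)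
flipⁿ-even (suc (suc n)) c 2∣n+2 =
  trans (flipL-involutive (flipⁿ n c)) (flipⁿ-even n c (∣m+n∣m⇒∣n 2∣n+2 ∣-refl))

flipⁿ-odd : ∀ n c → ¬ 2 ∣ n → flipⁿ n c ≡ flipL c
flipⁿ-odd zero c 2∤0 = ⊥-elim (2∤0 (2 ∣0))
flipⁿ-odd (suc zero) c _ = refl
flipⁿ-odd (suc (suc n)) c 2∤n+2 =
  trans (flipL-involutive (flipⁿ n c)) (flipⁿ-odd n c (2∤n+2 ∘ ∣m∣n⇒∣m+n ∣-refl))

flipⁿ-fixed⇒even : ∀ n c → flipⁿ n c ≡ c → 2 ∣ n
flipⁿ-fixed⇒even zero c _ = 2 ∣0
flipⁿ-fixed⇒even (suc zero) c fixed = ⊥-elim (flipL-≢ c fixed)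
flipⁿ-fixed⇒even (suc (suc n)) c fixed =
  ∣m∣n⇒∣m+n ∣-refl (flipⁿ-fixed⇒even n c (trans (sym (flipL-involutive (flipⁿ n c))) fixed))

flipⁿ-moved⇒odd : ∀ n c → flipⁿ n c ≡ flipL c → ¬ 2 ∣ n
flipⁿ-moved⇒odd n c moved 2∣n = flipL-≢ c (trans (sym moved) (flipⁿ-even n c 2∣n))

colour : ℕ → Letter
colour m = flipⁿ m one

twoIfEqual : Letter → Letter → Letter
twoIfEqual one one = two
twoIfEqual two two = two
twoIfEqual one two = one
twoIfEqual two one = one

twoIfEqual-diag : ∀ c → twoIfEqual c c ≡ two
twoIfEqual-diag one = refl
twoIfEqual-diag two = refl

twoIfEqual-flipLʳ : ∀ c → twoIfEqual c (flipL c) ≡ one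
twoIfEqual-flipLʳ one = refl
twoIfEqual-flipLʳ two = refl

twoIfEqual-flipL : ∀ x y → twoIfEqual (flipL x) (flipL y) ≡ twoIfEqual x y
twoIfEqual-flipL one one = refl
twoIfEqual-flipL one two = refl
twoIfEqual-flipL two one = refl
twoIfEqual-flipL two two = refl

twoIfEqual-flipⁿ : ∀ n x y → twoIfEqual (flipⁿ n x) (flipⁿ n y) ≡ twoIfEqual x y
twoIfEqual-flipⁿ zero x y = refl
twoIfEqual-flipⁿ (suc n) x y =
  trans (twoIfEqual-flipL (flipⁿ n x) (flipⁿ n y)) (twoIfEqual-flipⁿ n x y)

applyUpTo-+ : ∀ (f : ℕ → A) m n → applyUpTo f (m + n) ≡ applyUpTo f m ++ applyUpTo (λ j → f (m + j)) n
applyUpTo-+ f zero n = refl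
applyUpTo-+ f (suc m) n = cong (f 0 ∷_) (applyUpTo-+ (f ∘ suc) m n)

applyUpTo-cong : ∀ {f g : ℕ → A} n → (∀ j → j < n → f j ≡ g j) → applyUpTo f n ≡ applyUpTo g n
applyUpTo-cong zero _ = refl
applyUpTo-cong (suc n) f≡g =
  cong₂ _∷_ (f≡g 0 (s≤s z≤n)) (applyUpTo-cong n (λ j j<n → f≡g (suc j) (s≤s j<n)))

applyUpTo-injective : ∀ {f g : ℕ → A} n → applyUpTo f n ≡ applyUpTo g n → ∀ j → j < n → f j ≡ g j
applyUpTo-injective (suc n) eq zero _ = ∷-injectiveˡ eq
applyUpTo-injective (suc n) eq (suc j) (s≤s j<n) = applyUpTo-injective n (∷-injectiveʳ eq) j j<n

applyUpTo≡replicate⇒≡ : ∀ {f : ℕ → A} {x} n → applyUpTo f n ≡ replicate n x → ∀ j → j < n → f j ≡ x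
applyUpTo≡replicate⇒≡ (suc n) eq zero _ = ∷-injectiveˡ eq
applyUpTo≡replicate⇒≡ (suc n) eq (suc j) (s≤s j<n) = applyUpTo≡replicate⇒≡ n (∷-injectiveʳ eq) j j<n

integralFrom-++ : ∀ c x y → integralFrom c (x ++ y) ≡ integralFrom c x ++ integralFrom (flipⁿ (length x) c) y
integralFrom-++ c [] y = refl
integralFrom-++ c (a ∷ x) y = begin
  replicate (val a) c ++ integralFrom (flipL c) (x ++ y)
    ≡⟨ cong (replicate (val a) c ++_) (integralFrom-++ (flipL c) x y) ⟩
  replicate (val a) c ++ (integralFrom (flipL c) x ++ integralFrom (flipⁿ (length x) (flipL c)) y)
    ≡⟨ sym (++-assoc (replicate (val a) c) (integralFrom (flipL c) x) _) ⟩
  (replicate (val a) c ++ integralFrom (flipL c) x) ++ integralFrom (flipⁿ (length x) (flipL c)) y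
    ≡⟨ cong (λ d → (replicate (val a) c ++ integralFrom (flipL c) x) ++ integralFrom d y)
            (flipⁿ-flipL (length x) c) ⟩
  (replicate (val a) c ++ integralFrom (flipL c) x) ++ integralFrom (flipⁿ (suc (length x)) c) y ∎
  where open ≡-Reasoning

window : ℕ → ℕ
window zero = 5
window (suc H) = suc (window H + window H)

5≤window : ∀ H → 5 ≤ window H
5≤window zero = ≤-refl
5≤window (suc H) = ≤-trans (5≤window H) (≤-trans (m≤m+n _ _) (n≤1+n _))

module Runs (S : Stream) where

  ℓ : ℕ → ℕ
  ℓ zero = 0
  ℓ (suc m) = ℓ m + val (S m)

  integral-prefix-suc : ∀ m → integral (prefix S (suc m)) ≡ integral (prefix S m) ++ replicate (val (S m)) (colour m)
  integral-prefix-suc m = begin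
    integral (prefix S (suc m))
      ≡⟨ cong integral (sym (applyUpTo-∷ʳ S m)) ⟩
    integral (prefix S m ++ S m ∷ [])
      ≡⟨ integralFrom-++ one (prefix S m) (S m ∷ []) ⟩
    integral (prefix S m) ++ (replicate (val (S m)) (flipⁿ (length (prefix S m)) one) ++ [])
      ≡⟨ cong (λ w → integral (prefix S m) ++ w) (++-identityʳ _) ⟩
    integral (prefix S m) ++ replicate (val (S m)) (flipⁿ (length (prefix S m)) one)
      ≡⟨ cong (λ n → integral (prefix S m) ++ replicate (val (S m)) (colour n)) (length-applyUpTo S m) ⟩
    integral (prefix S m) ++ replicate (val (S m)) (colour m) ∎
    where open ≡-Reasoning

  length-integral-prefix : ∀ m → length (integral (prefix S m)) ≡ ℓ m
  length-integral-prefix zero = refl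
  length-integral-prefix (suc m) = begin
    length (integral (prefix S (suc m)))
      ≡⟨ cong length (integral-prefix-suc m) ⟩
    length (integral (prefix S m) ++ replicate (val (S m)) (colour m))
      ≡⟨ length-++ (integral (prefix S m)) ⟩
    length (integral (prefix S m)) + length (replicate (val (S m)) (colour m))
      ≡⟨ cong₂ _+_ (length-integral-prefix m) (length-replicate (val (S m))) ⟩
    ℓ m + val (S m) ∎
    where open ≡-Reasoning

  ℓ-<-suc : ∀ m → ℓ m < ℓ (suc m)
  ℓ-<-suc m = subst (_≤ ℓ (suc m)) (+-comm (ℓ m) 1) (+-monoʳ-≤ (ℓ m) (val-pos (S m)))

  ℓ-monotone : ∀ {m n} → m ≤ n → ℓ m ≤ ℓ n
  ℓ-monotone = go ∘ ≤⇒≤′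
    where
    go : ∀ {m n} → m ≤′ n → ℓ m ≤ ℓ n
    go ≤′-refl = ≤-refl
    go (≤′-step m≤n) = ≤-trans (go m≤n) (<⇒≤ (ℓ-<-suc _))

  ℓ-cancel-< : ∀ {m n} → ℓ m < ℓ n → m < n
  ℓ-cancel-< ℓm<ℓn = ≰⇒> (λ n≤m → <⇒≱ ℓm<ℓn (ℓ-monotone n≤m))

  n≤ℓn : ∀ n → n ≤ ℓ n
  n≤ℓn zero = z≤n
  n≤ℓn (suc n) = ≤-<-trans (n≤ℓn n) (ℓ-<-suc n)

  ℓn≤n+n : ∀ n → ℓ n ≤ n + n
  ℓn≤n+n zero = z≤n
  ℓn≤n+n (suc n) = subst (ℓ n + val (S n) ≤_) n+n+2≡ (+-mono-≤ (ℓn≤n+n n) (val-≤2 (S n)))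
    where
    n+n+2≡ : n + n + 2 ≡ suc n + suc n
    n+n+2≡ = trans (+-comm (n + n) 2) (cong suc (sym (+-suc n n)))

  ℓ-window : ∀ H → ℓ (window H) < window (suc H)
  ℓ-window H = s≤s (ℓn≤n+n (window H))

  run-decomposition : ∀ t → ∃₂ λ m s → s < val (S m) × ℓ m + s ≡ t
  run-decomposition zero = 0 , 0 , val-pos (S 0) , refl
  run-decomposition (suc t) with run-decomposition t
  ... | m , s , s<v , ℓm+s≡t with suc s <? val (S m)
  ...   | yes s+1<v = m , suc s , s+1<v , trans (+-suc (ℓ m) s) (cong suc ℓm+s≡t)
  ...   | no s+1≮v = suc m , 0 , val-pos (S (suc m)) , (begin
    ℓ m + val (S m) + 0 ≡⟨ +-identityʳ _ ⟩
    ℓ m + val (S m)     ≡⟨ cong (ℓ m +_) (≤-antisym (≮⇒≥ s+1≮v) s<v) ⟩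
    ℓ m + suc s         ≡⟨ +-suc (ℓ m) s ⟩
    suc (ℓ m + s)       ≡⟨ cong suc ℓm+s≡t ⟩
    suc t               ∎)
    where open ≡-Reasoning

  -- A record rather than a bare Π-type, so that p, t and L can be inferred from a proof.
  record Copy (p t L : ℕ) : Set where
    constructor copying
    field agrees : ∀ j → j < L → S (t + j) ≡ flipⁿ p (S j)
  open Copy public

  Copy-≤ : ∀ {p t M N} → M ≤ N → Copy p t N → Copy p t M
  Copy-≤ M≤N copy = copying λ j j<M → agrees copy j (<-≤-trans j<M M≤N)

  Copy-extend : ∀ {p t L} → Copy p t L → S (t + L) ≡ flipⁿ p (S L) → Copy p t (suc L)
  Copy-extend {p} {t} {L} copy next = copying extended
    where
    extended : ∀ j → j < suc L → S (t + j) ≡ flipⁿ p (S j)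
    extended j j<L+1 with m≤n⇒m<n∨m≡n (s≤s⁻¹ j<L+1)
    ... | inj₁ j<L = agrees copy j j<L
    ... | inj₂ refl = next

  Copy-even : ∀ {p t L} → 2 ∣ p → Copy p t L → Copy 0 t L
  Copy-even {p} 2∣p copy = copying λ j j<L → trans (agrees copy j j<L) (flipⁿ-even p (S j) 2∣p)

  Copy-odd : ∀ {p t L} → ¬ 2 ∣ p → Copy p t L → Copy 1 t L
  Copy-odd {p} 2∤p copy = copying λ j j<L → trans (agrees copy j j<L) (flipⁿ-odd p (S j) 2∤p)

  ℓ-+ : ∀ {m r} → Copy 0 m r → ℓ (m + r) ≡ ℓ m + ℓ r
  ℓ-+ {m} {zero} _ = trans (cong ℓ (+-identityʳ m)) (sym (+-identityʳ (ℓ m)))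
  ℓ-+ {m} {suc r} copy = begin
    ℓ (m + suc r)
      ≡⟨ cong ℓ (+-suc m r) ⟩
    ℓ (m + r) + val (S (m + r))
      ≡⟨ cong₂ _+_ (ℓ-+ (Copy-≤ (n≤1+n r) copy)) (cong val (agrees copy r ≤-refl)) ⟩
    ℓ m + ℓ r + val (S r)
      ≡⟨ +-assoc (ℓ m) (ℓ r) _ ⟩
    ℓ m + ℓ (suc r) ∎
    where open ≡-Reasoning

module Kolakoski (S : Stream) (isK : IsKolakoski S) where

  open Runs S

  integral-prefix : ∀ m → integral (prefix S m) ≡ prefix S (ℓ m)
  integral-prefix m = trans (isK m) (cong (prefix S) (length-integral-prefix m))

  run : ∀ m s → s < val (S m) → S (ℓ m + s) ≡ colour m
  run m s s<v = applyUpTo≡replicate⇒≡ (val (S m)) runs s s<v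
    where
    runs : applyUpTo (λ j → S (ℓ m + j)) (val (S m)) ≡ replicate (val (S m)) (colour m)
    runs = ++-cancelˡ (prefix S (ℓ m)) _ _ (begin
      prefix S (ℓ m) ++ applyUpTo (λ j → S (ℓ m + j)) (val (S m))
        ≡⟨ sym (applyUpTo-+ S (ℓ m) (val (S m))) ⟩
      prefix S (ℓ (suc m))
        ≡⟨ sym (integral-prefix (suc m)) ⟩
      integral (prefix S (suc m))
        ≡⟨ integral-prefix-suc m ⟩
      integral (prefix S m) ++ replicate (val (S m)) (colour m)
        ≡⟨ cong (_++ replicate (val (S m)) (colour m)) (integral-prefix m) ⟩
      prefix S (ℓ m) ++ replicate (val (S m)) (colour m) ∎)
      where open ≡-Reasoning

  run-at : ∀ {m s t} → ℓ m + s ≡ t → s < val (S m) → S t ≡ colour m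
  run-at {m} {s} refl = run m s

  run-start : ∀ m → S (ℓ m) ≡ colour m
  run-start m = run-at (+-identityʳ (ℓ m)) (val-pos (S m))

  S₀ : S 0 ≡ one
  S₀ = run-start 0

  S₁ : S 1 ≡ two
  S₁ = run-at {1} {0} (cong (λ c → val c + 0) S₀) (val-pos (S 1))

  S₂ : S 2 ≡ two
  S₂ = run-at {1} {1} (cong (λ c → val c + 1) S₀) (subst (λ c → 1 < val c) (sym S₁) ≤-refl)

  S₃ : S 3 ≡ one
  S₃ = run-at {2} {0} (cong₂ (λ a b → val a + val b + 0) S₀ S₁) (val-pos (S 2))

  S₄ : S 4 ≡ one
  S₄ = run-at {2} {1} (cong₂ (λ a b → val a + val b + 1) S₀ S₁) (subst (λ c → 1 < val c) (sym S₂) ≤-refl)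

  run-letter : ∀ r → S r ≡ twoIfEqual (S (ℓ r)) (S (suc (ℓ r)))
  run-letter r with S r in Sr
  ... | one = sym (begin
    twoIfEqual (S (ℓ r)) (S (suc (ℓ r)))
      ≡⟨ cong₂ twoIfEqual (run-start r) (run-at next-start (val-pos (S (suc r)))) ⟩
    twoIfEqual (colour r) (flipL (colour r))
      ≡⟨ twoIfEqual-flipLʳ (colour r) ⟩
    one ∎)
    where
    open ≡-Reasoning
    next-start : ℓ (suc r) + 0 ≡ suc (ℓ r)
    next-start = trans (+-identityʳ _) (trans (cong (λ c → ℓ r + val c) Sr) (+-comm (ℓ r) 1))
  ... | two = sym (begin
    twoIfEqual (S (ℓ r)) (S (suc (ℓ r)))
      ≡⟨ cong₂ twoIfEqual (run-start r) (run-at (+-comm (ℓ r) 1) (subst (λ c → 1 < val c) (sym Sr) ≤-refl)) ⟩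
    twoIfEqual (colour r) (colour r)
      ≡⟨ twoIfEqual-diag (colour r) ⟩
    two ∎)
    where open ≡-Reasoning

  next-run-differs : ∀ m s → s < val (S m) → S (ℓ m + s) ≢ S (ℓ (suc m))
  next-run-differs m s s<v eq = flipL-≢ (colour m) (trans (sym (run-start (suc m))) (trans (sym eq) (run m s s<v)))

  no-three-equal : ∀ t → S t ≡ S (suc t) → S t ≡ S (suc (suc t)) → ⊥
  no-three-equal t St≡St+1 St≡St+2 with run-decomposition t
  ... | m , s , s<v , refl with next-start-cases (ℓ m) s<v
  ...   | inj₁ next = next-run-differs m s s<v (trans St≡St+1 (cong S (sym next)))
  ...   | inj₂ next = next-run-differs m s s<v (trans St≡St+2 (cong S (sym next)))

  letter-of-copied-run : ∀ {p t N r j} → Copy p t N → ℓ r ≡ t + j → suc j < N →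
                         S r ≡ twoIfEqual (S j) (S (suc j))
  letter-of-copied-run {p} {t} {_} {r} {j} copy ℓr≡t+j j+1<N = begin
    S r
      ≡⟨ run-letter r ⟩
    twoIfEqual (S (ℓ r)) (S (suc (ℓ r)))
      ≡⟨ cong₂ (λ u v → twoIfEqual (S u) (S v)) ℓr≡t+j (trans (cong suc ℓr≡t+j) (sym (+-suc t j))) ⟩
    twoIfEqual (S (t + j)) (S (t + suc j))
      ≡⟨ cong₂ twoIfEqual (agrees copy j (<-trans (n<1+n j) j+1<N)) (agrees copy (suc j) j+1<N) ⟩
    twoIfEqual (flipⁿ p (S j)) (flipⁿ p (S (suc j)))
      ≡⟨ twoIfEqual-flipⁿ p (S j) (S (suc j)) ⟩
    twoIfEqual (S j) (S (suc j)) ∎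
    where open ≡-Reasoning

  copy-aligned : ∀ {p t} → Copy p t 5 → ∃ λ m → ℓ m ≡ t
  copy-aligned {t = t} copy with run-decomposition t
  ... | m , zero , _ , ℓm+0≡t = m , trans (sym (+-identityʳ (ℓ m))) ℓm+0≡t
  ... | m , suc (suc s) , s<v , _ = ⊥-elim (<⇒≱ (≤-trans s<v (val-≤2 (S m))) (m≤m+n 2 s))
  -- Starting in the middle of a run of length two, the copied 12211 forces the runs m, m + 1 and
  -- m + 2 to have length two as well: three consecutive 2s in S.
  ... | m , suc zero , 1<v , refl = ⊥-elim (no-three-equal m (trans Sm (sym Sm+1)) (trans Sm (sym Sm+2)))
    where
    open ≡-Reasoning
    Sm : S m ≡ two
    Sm = 1<val⇒two 1<v
    start₁ : ℓ (suc m) ≡ (ℓ m + 1) + 1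
    start₁ = trans (cong (λ c → ℓ m + val c) Sm) (sym (+-assoc (ℓ m) 1 1))
    Sm+1 : S (suc m) ≡ two
    Sm+1 = begin
      S (suc m)                    ≡⟨ letter-of-copied-run copy start₁ (s≤s (s≤s (s≤s z≤n))) ⟩
      twoIfEqual (S 1) (S 2)       ≡⟨ cong₂ twoIfEqual S₁ S₂ ⟩
      two                          ∎
    start₂ : ℓ (suc (suc m)) ≡ (ℓ m + 1) + 3
    start₂ = trans (cong₂ (λ a c → a + val c) start₁ Sm+1) (+-assoc (ℓ m + 1) 1 2)
    Sm+2 : S (suc (suc m)) ≡ two
    Sm+2 = begin
      S (suc (suc m))              ≡⟨ letter-of-copied-run copy start₂ ≤-refl ⟩
      twoIfEqual (S 3) (S 4)       ≡⟨ cong₂ twoIfEqual S₃ S₄ ⟩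
      two                          ∎

  run-copy-derivative : ∀ {p m N} L → Copy p (ℓ m) N → ℓ L < N → Copy 0 m L
  run-copy-derivative zero _ _ = copying λ _ ()
  run-copy-derivative {m = m} (suc L) copy ℓL+1<N = Copy-extend shorter (begin
      S (m + L)
        ≡⟨ letter-of-copied-run copy (ℓ-+ shorter) (≤-<-trans (ℓ-<-suc L) ℓL+1<N) ⟩
      twoIfEqual (S (ℓ L)) (S (suc (ℓ L)))
        ≡⟨ sym (run-letter L) ⟩
      S L ∎)
    where
    open ≡-Reasoning
    shorter : Copy 0 m L
    shorter = run-copy-derivative L copy (<-trans (ℓ-<-suc L) ℓL+1<N)

  run-copy-colour : ∀ {p m N} → Copy p (ℓ m) N → 0 < N → colour m ≡ flipⁿ p one
  run-copy-colour {p} {m} copy 0<N = begin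
    colour m           ≡⟨ sym (run-start m) ⟩
    S (ℓ m)            ≡⟨ cong S (sym (+-identityʳ (ℓ m))) ⟩
    S (ℓ m + 0)        ≡⟨ agrees copy 0 0<N ⟩
    flipⁿ p (S 0)      ≡⟨ cong (flipⁿ p) S₀ ⟩
    flipⁿ p one        ∎
    where open ≡-Reasoning

  copy-derivative : ∀ {p t N} L → Copy p t N → 5 ≤ N → ℓ L < N →
                    ∃ λ m → ℓ m ≡ t × Copy 0 m L × colour m ≡ flipⁿ p one
  copy-derivative L copy 5≤N ℓL<N with copy-aligned (Copy-≤ 5≤N copy)
  ... | m , refl = m , refl , run-copy-derivative {m = m} L copy ℓL<N ,
                   run-copy-colour {m = m} copy (<-≤-trans (s≤s z≤n) 5≤N)

  copy-run : ∀ {m L r s} → Copy 0 m L → r ≤ L → s < val (S r) → s < val (S (m + r)) →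
             S (ℓ m + (ℓ r + s)) ≡ flipⁿ m (S (ℓ r + s))
  copy-run {m} {_} {r} {s} copy r≤L s<v s<v′ = begin
    S (ℓ m + (ℓ r + s))        ≡⟨ cong S (sym (+-assoc (ℓ m) (ℓ r) s)) ⟩
    S (ℓ m + ℓ r + s)          ≡⟨ cong (λ u → S (u + s)) (sym (ℓ-+ (Copy-≤ r≤L copy))) ⟩
    S (ℓ (m + r) + s)          ≡⟨ run (m + r) s s<v′ ⟩
    colour (m + r)             ≡⟨ fold-+ one flipL m ⟩
    flipⁿ m (colour r)         ≡⟨ cong (flipⁿ m) (sym (run r s s<v)) ⟩
    flipⁿ m (S (ℓ r + s))      ∎
    where open ≡-Reasoning

  copy-integral : ∀ {m L} → Copy 0 m L → Copy m (ℓ m) (suc (ℓ L))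
  copy-integral {m} {L} copy = copying integrated
    where
    integrated : ∀ j → j < suc (ℓ L) → S (ℓ m + j) ≡ flipⁿ m (S j)
    integrated j j≤ℓL with m≤n⇒m<n∨m≡n (s≤s⁻¹ j≤ℓL)
    ... | inj₂ refl =
      subst (λ u → S (ℓ m + u) ≡ flipⁿ m (S u)) (+-identityʳ (ℓ L))
        (copy-run copy ≤-refl (val-pos (S L)) (val-pos (S (m + L))))
    ... | inj₁ j<ℓL with run-decomposition j
    ...   | r , s , s<v , refl = copy-run copy (<⇒≤ r<L) s<v (subst (λ c → s < val c) (sym (agrees copy r r<L)) s<v)
      where
      r<L : r < L
      r<L = ℓ-cancel-< (≤-<-trans (m≤m+n (ℓ r) s) j<ℓL)

  integralPow-prefix : ∀ h a → integralPow h (prefix S a) ≡ prefix S (fold a ℓ h)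
  integralPow-prefix zero a = refl
  integralPow-prefix (suc h) a = trans (cong integral (integralPow-prefix h a)) (integral-prefix (fold a ℓ h))

  regular-prefix⇔ : ∀ {k a} → Regular k (prefix S a) ⇔ (∀ h → h ≤ k → 2 ∣ fold a ℓ h)
  regular-prefix⇔ {a = a} = mk⇔ (λ reg h h≤k → subst (2 ∣_) (length≡ h) (reg h h≤k))
                                 (λ evens h h≤k → subst (2 ∣_) (sym (length≡ h)) (evens h h≤k))
    where
    length≡ : ∀ h → length (integralPow h (prefix S a)) ≡ fold a ℓ h
    length≡ h = trans (cong length (integralPow-prefix h a)) (length-applyUpTo S (fold a ℓ h))

  descend : ∀ H t → Copy 0 t (window H) → ∃ λ a → fold a ℓ H ≡ t × (∀ h → h < H → 2 ∣ fold a ℓ h)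
  descend zero t _ = t , refl , λ _ ()
  descend (suc H) t copy with copy-derivative (window H) copy (5≤window (suc H)) (ℓ-window H)
  ... | m , ℓm≡t , copy′ , colour-m with descend H m copy′
  ...   | a , ℓᴴa≡m , evens = a , trans (cong ℓ ℓᴴa≡m) ℓm≡t , evens′
    where
    evens′ : ∀ h → h < suc H → 2 ∣ fold a ℓ h
    evens′ h h<H+1 with m≤n⇒m<n∨m≡n (s≤s⁻¹ h<H+1)
    ... | inj₁ h<H = evens h h<H
    ... | inj₂ refl = subst (2 ∣_) (sym ℓᴴa≡m) (flipⁿ-fixed⇒even m one colour-m)

  ascend : ∀ a d → (∀ h → h < d → 2 ∣ fold a ℓ h) → ∃ λ L → d ≤ L × Copy 0 (fold a ℓ d) L
  ascend a zero _ = 0 , z≤n , copying λ _ ()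
  ascend a (suc d) evens with ascend a d (λ h h<d → evens h (m<n⇒m<1+n h<d))
  ... | L , d≤L , copy =
    suc (ℓ L) , s≤s (≤-trans d≤L (n≤ℓn L)) , Copy-even (evens d ≤-refl) (copy-integral copy)

  mirror-copy : MirrorInvariant S → ∀ L → ∃ λ i → Copy 1 i L
  mirror-copy mi L with mi (prefix S L) (0 , cong (applyUpTo S) (sym (length-applyUpTo S L)))
  ... | i , mirrored = i , copying λ j j<L → sym (applyUpTo-injective L flipped j j<L)
    where
    flipped : applyUpTo (flipL ∘ S) L ≡ applyUpTo (λ j → S (i + j)) L
    flipped = trans (sym (map-applyUpTo S flipL L))
                (trans mirrored (cong (applyUpTo _) (trans (length-map flipL (prefix S L)) (length-applyUpTo S L))))

  mirror-factor : ∀ {T N i} v → Copy 1 T N → v ≡ applyUpTo (λ j → S (i + j)) (length v) →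
                  i + length v ≤ N → Factor (mirror v) S
  mirror-factor {T} {_} {i} v copy v≡ i+|v|≤N = T + i , (begin
    mirror v                                          ≡⟨ cong mirror v≡ ⟩
    map flipL (applyUpTo (λ j → S (i + j)) (length v)) ≡⟨ map-applyUpTo _ flipL (length v) ⟩
    applyUpTo (λ j → flipL (S (i + j))) (length v)    ≡⟨ applyUpTo-cong (length v) shifted ⟩
    applyUpTo (λ j → S (T + i + j)) (length v)        ≡⟨ cong (applyUpTo _) (sym (length-map flipL v)) ⟩
    applyUpTo (λ j → S (T + i + j)) (length (mirror v)) ∎)
    where
    open ≡-Reasoning
    shifted : ∀ j → j < length v → flipL (S (i + j)) ≡ S (T + i + j)
    shifted j j<|v| = sym (trans (cong S (+-assoc T i j)) (agrees copy (i + j) (<-≤-trans (+-monoʳ-< i j<|v|) i+|v|≤N)))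

  mirror-invariant⇒normal-prefixes : MirrorInvariant S →
                                     ∀ n → 1 ≤ n → ∃ λ k → n < k × ∃ λ m → Normal k (prefix S m)
  mirror-invariant⇒normal-prefixes mi n _ with mirror-copy mi (window (suc (suc (suc n))))
  ... | i , copy with copy-derivative (window (suc (suc n))) copy (5≤window (suc (suc (suc n)))) (ℓ-window (suc (suc n)))
  ...   | m , _ , copy′ , colour-m with descend (suc (suc n)) m copy′
  ...     | a , ℓᴴa≡m , evens = suc n , ≤-refl , a , regular , not-regular
    where
    regular : Regular (suc n) (prefix S a)
    regular = Equivalence.from regular-prefix⇔ (λ h h≤n+1 → evens h (s≤s h≤n+1))
    not-regular : ¬ Regular (suc (suc n)) (prefix S a)
    not-regular reg = flipⁿ-moved⇒odd m one colour-m
      (subst (2 ∣_) ℓᴴa≡m (Equivalence.to regular-prefix⇔ reg (suc (suc n)) ≤-refl))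

  normal-prefixes⇒mirror-invariant : (∀ n → 1 ≤ n → ∃ λ k → n < k × ∃ λ m → Normal k (prefix S m)) →
                                     MirrorInvariant S
  normal-prefixes⇒mirror-invariant normal v (i , v≡) with normal (suc (i + length v)) (s≤s z≤n)
  ... | k , n<k , a , regular , not-regular
    with ascend a (suc k) (λ h h<k+1 → Equivalence.to regular-prefix⇔ regular h (s≤s⁻¹ h<k+1))
  ...   | L , k<L , copy = mirror-factor v (Copy-odd odd (copy-integral copy)) v≡ long-enough
    where
    odd : ¬ 2 ∣ fold a ℓ (suc k)
    odd 2∣ℓᵏ⁺¹a = not-regular (Equivalence.from regular-prefix⇔ evens)
      where
      evens : ∀ h → h ≤ suc k → 2 ∣ fold a ℓ h
      evens h h≤k+1 with m≤n⇒m<n∨m≡n h≤k+1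
      ... | inj₁ h<k+1 = Equivalence.to regular-prefix⇔ regular h (s≤s⁻¹ h<k+1)
      ... | inj₂ refl = 2∣ℓᵏ⁺¹a
    long-enough : i + length v ≤ suc (ℓ L)
    long-enough = begin
      i + length v       ≤⟨ n≤1+n _ ⟩
      suc (i + length v) <⟨ n<k ⟩
      k                  <⟨ k<L ⟩
      L                  ≤⟨ n≤ℓn L ⟩
      ℓ L                <⟨ n<1+n (ℓ L) ⟩
      suc (ℓ L)          ∎
      where open ≤-Reasoning

lemma9 : (S : Stream) → IsKolakoski S →
         (MirrorInvariant S ⇔ (∀ (n : ℕ) → 1 ≤ n → ∃ λ k → n < k × ∃ λ m → Normal k (prefix S m)))
lemma9 S isK = mk⇔ mirror-invariant⇒normal-prefixes normal-prefixes⇒mirror-invariant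
  where open Kolakoski S isK
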